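{- Let $V$ be a $3$-dimensional vector space over a field $K$, equipped with a bracket (a nonzero alternating trilinear form) $[\cdot\,\cdot\,\cdot]$, and consider the Grassmann–Cayley algebra of step $3$ on $V$, with join $\vee$ and meet $\wedge$ as described in the context. Then for all vectors $a,b,c,a',b',c'\in V$, $$(bc' \wedge b'c) \vee (ca' \wedge c'a) \vee (ab' \wedge a'b) = (c'b \wedge b'c) \vee (ca' \wedge ab) \vee (ab' \wedge a'c').$$
   Context: Grassmann–Cayley algebra of step $3$: the exterior algebra of a $3$-dimensional vector space $V$ over a field $K$, with a fixed bracket $[xyz]$ (a nonzero alternating trilinear form on $V$, e.g. the determinant in a fixed basis). The join $\vee$ is the exterior product; juxtaposition $xy$ denotes the join $x\vee y$ of two vectors (an extensor of step $2$, representing the line through the points $x,y$). The join of three vectors is identified with the scalar $x\vee y\vee z=[xyz]$. The meet of two step-$2$ extensors is the vector $$xy \wedge zw = [xyw]\,z - [xyz]\,w$$ (representing the intersection point of the two lines). Thus each side of the identity is the join of three vectors, i.e. the scalar $[pqr]$ where $p,q,r$ are the three meets. -}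

module Defs where

open import Level using (Level; _⊔_)
open import Algebra.Bundles using (CommutativeRing)
open import Data.Product using (Σ; _×_; _,_)
open import Relation.Nullary using (¬_)

record IsField {c ℓ : Level} (R : CommutativeRing c ℓ) : Set (c ⊔ ℓ) where
  open CommutativeRing R
  field
    0≉1     : ¬ (0# ≈ 1#)
    inverse : ∀ x → ¬ (x ≈ 0#) → Σ Carrier λ y → x * y ≈ 1#

module GC {c ℓ : Level} (K : CommutativeRing c ℓ) where
  open CommutativeRing K

  record V : Set c where
    constructor ⟨_,_,_⟩
    field
      v₁ v₂ v₃ : Carrier
  open V public

  _≈ᵥ_ : V → V → Set ℓ
  x ≈ᵥ y = (v₁ x ≈ v₁ y) × (v₂ x ≈ v₂ y) × (v₃ x ≈ v₃ y)

  infixl 6 _+ᵥ_ _-ᵥ_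
  infixr 7 _·_

  _+ᵥ_ : V → V → V
  x +ᵥ y = ⟨ v₁ x + v₁ y , v₂ x + v₂ y , v₃ x + v₃ y ⟩

  _·_ : Carrier → V → V
  λ' · x = ⟨ λ' * v₁ x , λ' * v₂ x , λ' * v₃ x ⟩

  _-ᵥ_ : V → V → V
  x -ᵥ y = x +ᵥ ((- 1#) · y)

  record IsBracket (br : V → V → V → Carrier) : Set (c ⊔ ℓ) where
    field
      cong-br : ∀ {x x' y y' z z'} → x ≈ᵥ x' → y ≈ᵥ y' → z ≈ᵥ z' →
                br x y z ≈ br x' y' z'
      lin₁ : ∀ α β x x' y z →
             br ((α · x) +ᵥ (β · x')) y z ≈ α * br x y z + β * br x' y z
      lin₂ : ∀ α β x y y' z →
             br x ((α · y) +ᵥ (β · y')) z ≈ α * br x y z + β * br x y' z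
      lin₃ : ∀ α β x y z z' →
             br x y ((α · z) +ᵥ (β · z')) ≈ α * br x y z + β * br x y z'
      alt₁₂ : ∀ x z → br x x z ≈ 0#
      alt₁₃ : ∀ x y → br x y x ≈ 0#
      alt₂₃ : ∀ x y → br x y y ≈ 0#
      nonzero : Σ V λ x → Σ V λ y → Σ V λ z → ¬ (br x y z ≈ 0#)

  module Bracket (br : V → V → V → Carrier) where
    -- The meet of the lines xy and zw:  xy ∧ zw = [xyw] z − [xyz] w.
    meet : V → V → V → V → V
    meet x y z w = (br x y w · z) -ᵥ (br x y z · w)

    -- The join of three vectors p ∨ q ∨ r, identified with the scalar [pqr].
    join3 : V → V → V → Carrier
    join3 p q r = br p q r

module Submission where

-- Every alternating trilinear form on K³ is a multiple of the determinant,
-- so brackets satisfy the Grassmann–Plücker relation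
--   [pab][pcd] − [pac][pbd] + [pad][pbc] = 0.
-- Expanding the meets trilinearly and normalising brackets by antisymmetry,
-- the left side becomes [b'aa'][b'bc'][cab][ca'c'] − [caa'][cbc'][b'ab][b'a'c']
-- and the right side [caa'][cbc'][b'ac'][b'ba'] − [b'aa'][b'bc'][cac'][cba'];
-- the relations with p = b' and p = c (and a, b, a', c') turn one into the other.

open import Level using (Level; _⊔_)
open import Algebra.Bundles using (CommutativeRing)
open import Algebra.Solver.Ring.AlmostCommutativeRing
  using (fromCommutativeRing; _-Raw-AlmostCommutative⟶_)
open import Data.Fin using (Fin)
open import Data.Fin.Patterns using (0F; 1F; 2F)
open import Data.Integer as ℤ using (ℤ; +_; -[1+_]; _⊖_; ∣_∣; sign; _◃_)
import Data.Integer.Properties as ℤ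
open import Data.Maybe using (Maybe; just; nothing)
open import Data.Nat as ℕ using (ℕ; zero; suc)
import Data.Nat.Properties as ℕ
open import Data.Product using (_,_)
open import Data.Sign as Sign using (Sign)
open import Function using (_∘_)
import Relation.Binary.PropositionalEquality as ≡
open import Relation.Nullary using (yes; no)
open import Defs

-- Solver coefficients must compute and have decidable equality, which an
-- abstract K does not offer; ℤ does, via its canonical map into K.
module IntegerCoefficients {c ℓ : Level} (K : CommutativeRing c ℓ) where
  open CommutativeRing K
  open import Relation.Binary.Reasoning.Setoid setoid
  open import Algebra.Properties.Semiring.Mult.TCOptimised semiring
    using (_×_; 1+×; ×-homo-+; ×1-homo-*)
  open import Algebra.Properties.AbelianGroup +-abelianGroup
    using (⁻¹-∙-comm; ⁻¹-involutive; ε⁻¹≈ε)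
  open import Algebra.Properties.CommutativeSemigroup
  open import Algebra.Properties.Ring ring using (-1*x≈-x)

  ⟦_⟧ : ℤ → Carrier
  ⟦ + n ⟧    = n × 1#
  ⟦ -[1+ n ] ⟧ = - (suc n × 1#)

  private
    ⊖-homo : ∀ m n → ⟦ m ⊖ n ⟧ ≈ m × 1# - n × 1#
    ⊖-homo m       zero    = begin
      m × 1#          ≈⟨ +-identityʳ _ ⟨
      m × 1# + 0#     ≈⟨ +-congˡ ε⁻¹≈ε ⟨
      m × 1# - 0#     ∎
    ⊖-homo zero    (suc n) = sym (+-identityˡ _)
    ⊖-homo (suc m) (suc n) = begin
      ⟦ suc m ⊖ suc n ⟧                    ≡⟨ ≡.cong ⟦_⟧ (ℤ.[1+m]⊖[1+n]≡m⊖n m n) ⟩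
      ⟦ m ⊖ n ⟧                            ≈⟨ ⊖-homo m n ⟩
      m × 1# - n × 1#                      ≈⟨ +-identityˡ _ ⟨
      0# + (m × 1# - n × 1#)               ≈⟨ +-congʳ (-‿inverseʳ 1#) ⟨
      (1# - 1#) + (m × 1# - n × 1#)        ≈⟨ interchange +-commutativeSemigroup _ _ _ _ ⟩
      (1# + m × 1#) + (- 1# - n × 1#)      ≈⟨ +-congˡ (⁻¹-∙-comm _ _) ⟩
      (1# + m × 1#) - (1# + n × 1#)        ≈⟨ +-cong (1+× m 1#) (-‿cong (1+× n 1#)) ⟨
      suc m × 1# - suc n × 1#              ∎

    +-homo : ∀ i j → ⟦ i ℤ.+ j ⟧ ≈ ⟦ i ⟧ + ⟦ j ⟧
    +-homo (+ m)      (+ n)      = ×-homo-+ 1# m n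
    +-homo (+ m)      -[1+ n ]   = ⊖-homo m (suc n)
    +-homo -[1+ m ]   (+ n)      = trans (⊖-homo n (suc m)) (+-comm _ _)
    +-homo -[1+ m ]   -[1+ n ]   = begin
      - (suc (suc (m ℕ.+ n)) × 1#)         ≡⟨ ≡.cong (λ k → - (k × 1#)) (ℕ.+-suc (suc m) n) ⟨
      - ((suc m ℕ.+ suc n) × 1#)           ≈⟨ -‿cong (×-homo-+ 1# (suc m) (suc n)) ⟩
      - (suc m × 1# + suc n × 1#)          ≈⟨ ⁻¹-∙-comm _ _ ⟨
      - (suc m × 1#) - (suc n × 1#)        ∎

    -‿homo : ∀ i → ⟦ ℤ.- i ⟧ ≈ - ⟦ i ⟧
    -‿homo (+ zero)  = sym ε⁻¹≈ε
    -‿homo (+ suc n) = refl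
    -‿homo -[1+ n ]  = sym (⁻¹-involutive _)

    ⟦_⟧ₛ : Sign → Carrier
    ⟦ Sign.+ ⟧ₛ = 1#
    ⟦ Sign.- ⟧ₛ = - 1#

    ◃-homo : ∀ s n → ⟦ s ◃ n ⟧ ≈ ⟦ s ⟧ₛ * (n × 1#)
    ◃-homo s        zero    = sym (zeroʳ _)
    ◃-homo Sign.+   (suc n) = sym (*-identityˡ _)
    ◃-homo Sign.-   (suc n) = sym (-1*x≈-x _)

    sign-homo : ∀ s t → ⟦ s Sign.* t ⟧ₛ ≈ ⟦ s ⟧ₛ * ⟦ t ⟧ₛ
    sign-homo Sign.+ t       = sym (*-identityˡ _)
    sign-homo Sign.- Sign.+  = sym (*-identityʳ _)
    sign-homo Sign.- Sign.-  = sym (trans (-1*x≈-x _) (⁻¹-involutive _))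

    *-homo : ∀ i j → ⟦ i ℤ.* j ⟧ ≈ ⟦ i ⟧ * ⟦ j ⟧
    *-homo i j = begin
      ⟦ (sign i Sign.* sign j) ◃ (∣ i ∣ ℕ.* ∣ j ∣) ⟧                 ≈⟨ ◃-homo _ (∣ i ∣ ℕ.* ∣ j ∣) ⟩
      ⟦ sign i Sign.* sign j ⟧ₛ * ((∣ i ∣ ℕ.* ∣ j ∣) × 1#)           ≈⟨ *-cong (sign-homo (sign i) (sign j)) (×1-homo-* ∣ i ∣ ∣ j ∣) ⟩
      (⟦ sign i ⟧ₛ * ⟦ sign j ⟧ₛ) * (∣ i ∣ × 1# * ∣ j ∣ × 1#)         ≈⟨ interchange *-commutativeSemigroup _ _ _ _ ⟩
      (⟦ sign i ⟧ₛ * ∣ i ∣ × 1#) * (⟦ sign j ⟧ₛ * ∣ j ∣ × 1#)         ≈⟨ *-cong (◃-homo (sign i) ∣ i ∣) (◃-homo (sign j) ∣ j ∣) ⟨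
      ⟦ sign i ◃ ∣ i ∣ ⟧ * ⟦ sign j ◃ ∣ j ∣ ⟧                         ≡⟨ ≡.cong₂ (λ i j → ⟦ i ⟧ * ⟦ j ⟧) (ℤ.◃-inverse i) (ℤ.◃-inverse j) ⟩
      ⟦ i ⟧ * ⟦ j ⟧                                                  ∎

    homomorphism : ℤ.+-*-rawRing -Raw-AlmostCommutative⟶ fromCommutativeRing K
    homomorphism = record
      { ⟦_⟧ = ⟦_⟧ ; +-homo = +-homo ; *-homo = *-homo ; -‿homo = -‿homo
      ; 0-homo = refl ; 1-homo = refl }

    ⟦⟧-≟ : ∀ i j → Maybe (⟦ i ⟧ ≈ ⟦ j ⟧)
    ⟦⟧-≟ i j with i ℤ.≟ j
    ... | yes ≡.refl = just refl
    ... | no  _      = nothing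

  open import Algebra.Solver.Ring ℤ.+-*-rawRing (fromCommutativeRing K) homomorphism ⟦⟧-≟ public
    using (Polynomial; con; _:+_; _:*_; :-_; _:-_; _:=_; solve)

levi-civita : Fin 3 → Fin 3 → Fin 3 → ℤ
levi-civita 0F 1F 2F = + 1
levi-civita 1F 2F 0F = + 1
levi-civita 2F 0F 1F = + 1
levi-civita 0F 2F 1F = -[1+ 0 ]
levi-civita 2F 1F 0F = -[1+ 0 ]
levi-civita 1F 0F 2F = -[1+ 0 ]
levi-civita _  _  _  = + 0

module ThreeSpace {c ℓ : Level} (K : CommutativeRing c ℓ) where
  open CommutativeRing K
  open GC K
  open IntegerCoefficients K
  open import Relation.Binary.Reasoning.Setoid setoid
  open import Algebra.Properties.AbelianGroup +-abelianGroup using (inverseʳ-unique)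

  ∑₃ : (Fin 3 → Carrier) → Carrier
  ∑₃ f = f 0F + f 1F + f 2F

  ∑₃-cong : ∀ {f g} → (∀ i → f i ≈ g i) → ∑₃ f ≈ ∑₃ g
  ∑₃-cong f≈g = +-cong (+-cong (f≈g 0F) (f≈g 1F)) (f≈g 2F)

  ∑₃-*-distribʳ : ∀ f a → ∑₃ f * a ≈ ∑₃ λ i → f i * a
  ∑₃-*-distribʳ f a = trans (distribʳ a _ _) (+-congʳ (distribʳ a _ _))

  coord : V → Fin 3 → Carrier
  coord x 0F = v₁ x
  coord x 1F = v₂ x
  coord x 2F = v₃ x

  basis : Fin 3 → V
  basis 0F = ⟨ 1# , 0# , 0# ⟩
  basis 1F = ⟨ 0# , 1# , 0# ⟩
  basis 2F = ⟨ 0# , 0# , 1# ⟩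

  infixr 7 _⊙_
  _⊙_ : V → (Fin 3 → Carrier) → Carrier
  x ⊙ f = ∑₃ λ i → coord x i * f i

  ⊙-cong : ∀ x {f g} → (∀ i → f i ≈ g i) → x ⊙ f ≈ x ⊙ g
  ⊙-cong x f≈g = ∑₃-cong λ i → *-congˡ {coord x i} (f≈g i)

  ⊙-*ʳ : ∀ x f a → (x ⊙ f) * a ≈ x ⊙ λ i → f i * a
  ⊙-*ʳ x f a = trans (∑₃-*-distribʳ (λ i → coord x i * f i) a) (∑₃-cong λ i → *-assoc (coord x i) (f i) a)

  module _ {n : ℕ} where
    :0 :1 : Polynomial n
    :0 = con (+ 0)
    :1 = con (+ 1)

    ∑₃ᵖ : (Fin 3 → Polynomial n) → Polynomial n
    ∑₃ᵖ f = f 0F :+ f 1F :+ f 2F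

    [_,_,_] : Polynomial n → Polynomial n → Polynomial n → Fin 3 → Polynomial n
    [ x , y , z ] 0F = x
    [ x , y , z ] 1F = y
    [ x , y , z ] 2F = z

    :det : (Fin 3 → Polynomial n) → (Fin 3 → Polynomial n) → (Fin 3 → Polynomial n) → Polynomial n
    :det X Y Z = ∑₃ᵖ λ i → X i :* ∑₃ᵖ λ j → Y j :* ∑₃ᵖ λ l → Z l :* con (levi-civita i j l)

    :binomial : (α β γ δ ε ζ t₁ t₂ t₃ t₄ t₅ t₆ t₇ t₈ : Polynomial n) → Polynomial n
    :binomial α β γ δ ε ζ t₁ t₂ t₃ t₄ t₅ t₆ t₇ t₈ =
      α :* (γ :* (ε :* t₁ :+ ζ :* t₂) :+ δ :* (ε :* t₃ :+ ζ :* t₄)) :+ β :* (γ :* (ε :* t₅ :+ ζ :* t₆) :+ δ :* (ε :* t₇ :+ ζ :* t₈))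

  ≈ᵥ-refl : ∀ {x} → x ≈ᵥ x
  ≈ᵥ-refl = refl , refl , refl

  record IsLinear (f : V → Carrier) : Set (c ⊔ ℓ) where
    field
      cong   : ∀ {x y} → x ≈ᵥ y → f x ≈ f y
      linear : ∀ α β x y → f (α · x +ᵥ β · y) ≈ α * f x + β * f y

  basis-decomposition : ∀ x → x ≈ᵥ (v₁ x · basis 0F +ᵥ 1# · (v₂ x · basis 1F +ᵥ v₃ x · basis 2F))
  basis-decomposition ⟨ x₁ , x₂ , x₃ ⟩ =
    solve 3 (λ x₁ x₂ x₃ → x₁ := x₁ :* :1 :+ :1 :* (x₂ :* :0 :+ x₃ :* :0)) refl x₁ x₂ x₃ ,
    solve 3 (λ x₁ x₂ x₃ → x₂ := x₁ :* :0 :+ :1 :* (x₂ :* :1 :+ x₃ :* :0)) refl x₁ x₂ x₃ ,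
    solve 3 (λ x₁ x₂ x₃ → x₃ := x₁ :* :0 :+ :1 :* (x₂ :* :0 :+ x₃ :* :1)) refl x₁ x₂ x₃

  linear-expansion : ∀ {f} → IsLinear f → ∀ x → f x ≈ x ⊙ f ∘ basis
  linear-expansion {f} f-linear x = begin
    f x                                                       ≈⟨ cong (basis-decomposition x) ⟩
    f (v₁ x · basis 0F +ᵥ 1# · (v₂ x · basis 1F +ᵥ v₃ x · basis 2F))
                                                              ≈⟨ linear _ _ _ _ ⟩
    v₁ x * f (basis 0F) + 1# * f (v₂ x · basis 1F +ᵥ v₃ x · basis 2F)
                                                              ≈⟨ +-congˡ (*-congˡ (linear _ _ _ _)) ⟩
    v₁ x * f (basis 0F) + 1# * (v₂ x * f (basis 1F) + v₃ x * f (basis 2F))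
                                                              ≈⟨ +-congˡ (*-identityˡ _) ⟩
    v₁ x * f (basis 0F) + (v₂ x * f (basis 1F) + v₃ x * f (basis 2F))
                                                              ≈⟨ +-assoc _ _ _ ⟨
    x ⊙ f ∘ basis                                             ∎
    where open IsLinear f-linear

  alternating⇒antisymmetric : (g : V → V → Carrier) →
    (∀ y → IsLinear λ x → g x y) → (∀ x → IsLinear (g x)) → (∀ x → g x x ≈ 0#) →
    ∀ x y → g y x ≈ - g x y
  alternating⇒antisymmetric g linearˡ linearʳ alternating x y =
    inverseʳ-unique (g x y) (g y x) (begin
      g x y + g y x                                        ≈⟨ rearrange ⟩
      1# * (1# * g x x + 1# * g x y) + 1# * (1# * g y x + 1# * g y y) - (g x x + g y y)
                                                           ≈⟨ +-cong (sym expand-diagonal) (-‿cong (+-cong (alternating x) (alternating y))) ⟩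
      g s s - (0# + 0#)                                    ≈⟨ +-cong (alternating s) (-‿cong (+-identityˡ 0#)) ⟩
      0# - 0#                                              ≈⟨ -‿inverseʳ 0# ⟩
      0#                                                   ∎)
    where
    s : V
    s = 1# · x +ᵥ 1# · y
    expand-diagonal : g s s ≈ 1# * (1# * g x x + 1# * g x y) + 1# * (1# * g y x + 1# * g y y)
    expand-diagonal = trans (IsLinear.linear (linearˡ s) 1# 1# x y)
      (+-cong (*-congˡ (IsLinear.linear (linearʳ x) 1# 1# x y)) (*-congˡ (IsLinear.linear (linearʳ y) 1# 1# x y)))
    rearrange : g x y + g y x ≈ 1# * (1# * g x x + 1# * g x y) + 1# * (1# * g y x + 1# * g y y) - (g x x + g y y)
    rearrange = solve 4 (λ xx xy yx yy →
      xy :+ yx := :1 :* (:1 :* xx :+ :1 :* xy) :+ :1 :* (:1 :* yx :+ :1 :* yy) :- (xx :+ yy))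
      refl (g x x) (g x y) (g y x) (g y y)

  expand₃ : V → V → V → (Fin 3 → Fin 3 → Fin 3 → Carrier) → Carrier
  expand₃ x y z t = x ⊙ λ i → y ⊙ λ j → z ⊙ t i j

  expand₃-cong : ∀ x y z {t u} → (∀ i j l → t i j l ≈ u i j l) → expand₃ x y z t ≈ expand₃ x y z u
  expand₃-cong x y z t≈u = ⊙-cong x λ i → ⊙-cong y λ j → ⊙-cong z (t≈u i j)

  expand₃-*ʳ : ∀ x y z t a → expand₃ x y z t * a ≈ expand₃ x y z λ i j l → t i j l * a
  expand₃-*ʳ x y z t a =
    trans (⊙-*ʳ x (λ i → y ⊙ λ j → z ⊙ t i j) a) (⊙-cong x λ i →
    trans (⊙-*ʳ y (λ j → z ⊙ t i j) a) (⊙-cong y λ j → ⊙-*ʳ z (t i j) a))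

  det : V → V → V → Carrier
  det x y z = expand₃ x y z λ i j l → ⟦ levi-civita i j l ⟧

  det-plücker : ∀ p a b c d → det p a b * det p c d + det p a d * det p b c ≈ det p a c * det p b d
  det-plücker ⟨ p₁ , p₂ , p₃ ⟩ ⟨ a₁ , a₂ , a₃ ⟩ ⟨ b₁ , b₂ , b₃ ⟩ ⟨ c₁ , c₂ , c₃ ⟩ ⟨ d₁ , d₂ , d₃ ⟩ =
    solve 15 (λ p₁ p₂ p₃ a₁ a₂ a₃ b₁ b₂ b₃ c₁ c₂ c₃ d₁ d₂ d₃ →
      let p = [ p₁ , p₂ , p₃ ]; a = [ a₁ , a₂ , a₃ ]; b = [ b₁ , b₂ , b₃ ]
          c = [ c₁ , c₂ , c₃ ]; d = [ d₁ , d₂ , d₃ ]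
      in :det p a b :* :det p c d :+ :det p a d :* :det p b c := :det p a c :* :det p b d)
      refl p₁ p₂ p₃ a₁ a₂ a₃ b₁ b₂ b₃ c₁ c₂ c₃ d₁ d₂ d₃

module BracketProperties {c ℓ : Level} (K : CommutativeRing c ℓ)
  (br : GC.V K → GC.V K → GC.V K → CommutativeRing.Carrier K) (isBracket : GC.IsBracket K br) where
  open CommutativeRing K
  open GC K
  open IntegerCoefficients K
  open ThreeSpace K
  open IsBracket isBracket
  open Bracket br
  open import Relation.Binary.Reasoning.Setoid setoid
  open import Algebra.Properties.AbelianGroup +-abelianGroup using (⁻¹-involutive)
  open import Algebra.Properties.Ring ring using (-1*x≈-x)

  linear₁ : ∀ y z → IsLinear λ x → br x y z
  linear₁ y z = record { cong = λ x≈x′ → cong-br x≈x′ ≈ᵥ-refl ≈ᵥ-refl ; linear = λ α β x x′ → lin₁ α β x x′ y z }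

  linear₂ : ∀ x z → IsLinear λ y → br x y z
  linear₂ x z = record { cong = λ y≈y′ → cong-br ≈ᵥ-refl y≈y′ ≈ᵥ-refl ; linear = λ α β y y′ → lin₂ α β x y y′ z }

  linear₃ : ∀ x y → IsLinear (br x y)
  linear₃ x y = record { cong = λ z≈z′ → cong-br ≈ᵥ-refl ≈ᵥ-refl z≈z′ ; linear = λ α β z z′ → lin₃ α β x y z z′ }

  br-swap₁₂ : ∀ x y z → br y x z ≈ - br x y z
  br-swap₁₂ x y z =
    alternating⇒antisymmetric (λ x y → br x y z) (λ y → linear₁ y z) (λ x → linear₂ x z) (λ x → alt₁₂ x z) x y

  br-swap₂₃ : ∀ x y z → br x z y ≈ - br x y z
  br-swap₂₃ x y z = alternating⇒antisymmetric (br x) (linear₂ x) (linear₃ x) (alt₂₃ x) y z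

  br-rotate : ∀ x y z → br y z x ≈ br x y z
  br-rotate x y z = begin
    br y z x        ≈⟨ br-swap₂₃ y x z ⟩
    - br y x z      ≈⟨ -‿cong (br-swap₁₂ x y z) ⟩
    - - br x y z    ≈⟨ ⁻¹-involutive _ ⟩
    br x y z        ∎

  trilinear-expansion : ∀ x y z → br x y z ≈ expand₃ x y z λ i j l → br (basis i) (basis j) (basis l)
  trilinear-expansion x y z =
    trans (linear-expansion (linear₁ y z) x) (⊙-cong x λ i →
    trans (linear-expansion (linear₂ (basis i) z) y) (⊙-cong y λ j →
    linear-expansion (linear₃ (basis i) (basis j)) z))

  κ : Carrier
  κ = br (basis 0F) (basis 1F) (basis 2F)

  private
    vanishing : ∀ {t} → t ≈ 0# → t ≈ 0# * κ
    vanishing t≈0 = trans t≈0 (sym (zeroˡ κ))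
    even : ∀ {t} → t ≈ κ → t ≈ 1# * κ
    even t≈κ = trans t≈κ (sym (*-identityˡ κ))
    odd : ∀ {t} → t ≈ - κ → t ≈ - 1# * κ
    odd t≈-κ = trans t≈-κ (sym (-1*x≈-x κ))

  br-basis : ∀ i j l → br (basis i) (basis j) (basis l) ≈ ⟦ levi-civita i j l ⟧ * κ
  br-basis 0F 0F l  = vanishing (alt₁₂ _ _)
  br-basis 1F 1F l  = vanishing (alt₁₂ _ _)
  br-basis 2F 2F l  = vanishing (alt₁₂ _ _)
  br-basis 0F 1F 0F = vanishing (alt₁₃ _ _)
  br-basis 0F 1F 1F = vanishing (alt₂₃ _ _)
  br-basis 0F 1F 2F = even refl
  br-basis 0F 2F 0F = vanishing (alt₁₃ _ _)
  br-basis 0F 2F 1F = odd (br-swap₂₃ _ _ _)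
  br-basis 0F 2F 2F = vanishing (alt₂₃ _ _)
  br-basis 1F 0F 0F = vanishing (alt₂₃ _ _)
  br-basis 1F 0F 1F = vanishing (alt₁₃ _ _)
  br-basis 1F 0F 2F = odd (br-swap₁₂ _ _ _)
  br-basis 1F 2F 0F = even (br-rotate _ _ _)
  br-basis 1F 2F 1F = vanishing (alt₁₃ _ _)
  br-basis 1F 2F 2F = vanishing (alt₂₃ _ _)
  br-basis 2F 0F 0F = vanishing (alt₂₃ _ _)
  br-basis 2F 0F 1F = even (trans (br-rotate _ _ _) (br-rotate _ _ _))
  br-basis 2F 0F 2F = vanishing (alt₁₃ _ _)
  br-basis 2F 1F 0F = odd (trans (br-swap₁₂ _ _ _) (-‿cong (br-rotate _ _ _)))
  br-basis 2F 1F 1F = vanishing (alt₂₃ _ _)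
  br-basis 2F 1F 2F = vanishing (alt₁₃ _ _)

  br≈det*κ : ∀ x y z → br x y z ≈ det x y z * κ
  br≈det*κ x y z = begin
    br x y z                                                     ≈⟨ trilinear-expansion x y z ⟩
    expand₃ x y z (λ i j l → br (basis i) (basis j) (basis l))   ≈⟨ expand₃-cong x y z br-basis ⟩
    expand₃ x y z (λ i j l → ⟦ levi-civita i j l ⟧ * κ)          ≈⟨ expand₃-*ʳ x y z (λ i j l → ⟦ levi-civita i j l ⟧) κ ⟨
    det x y z * κ                                                ∎

  grassmann-plücker : ∀ p a b c d → br p a b * br p c d + br p a d * br p b c ≈ br p a c * br p b d
  grassmann-plücker p a b c d = begin
    br p a b * br p c d + br p a d * br p b c
      ≈⟨ +-cong (*-cong (br≈det*κ p a b) (br≈det*κ p c d)) (*-cong (br≈det*κ p a d) (br≈det*κ p b c)) ⟩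
    (det p a b * κ) * (det p c d * κ) + (det p a d * κ) * (det p b c * κ)
      ≈⟨ solve 5 (λ ab cd ad bc k → (ab :* k) :* (cd :* k) :+ (ad :* k) :* (bc :* k) := (ab :* cd :+ ad :* bc) :* (k :* k))
                 refl (det p a b) (det p c d) (det p a d) (det p b c) κ ⟩
    (det p a b * det p c d + det p a d * det p b c) * (κ * κ)
      ≈⟨ *-congʳ (det-plücker p a b c d) ⟩
    (det p a c * det p b d) * (κ * κ)
      ≈⟨ solve 3 (λ ac bd k → (ac :* bd) :* (k :* k) := (ac :* k) :* (bd :* k)) refl (det p a c) (det p b d) κ ⟩
    (det p a c * κ) * (det p b d * κ)
      ≈⟨ *-cong (br≈det*κ p a c) (br≈det*κ p b d) ⟨
    br p a c * br p b d
      ∎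

  meet≈ : ∀ x y z w {α β} → br x y w ≈ α → br x y z ≈ β → meet x y z w ≈ᵥ (α · z +ᵥ (- β) · w)
  meet≈ x y z w {α} {β} xyw≈α xyz≈β = coordinate (v₁ z) (v₁ w) , coordinate (v₂ z) (v₂ w) , coordinate (v₃ z) (v₃ w)
    where
    coordinate : ∀ zᵢ wᵢ → br x y w * zᵢ + - 1# * (br x y z * wᵢ) ≈ α * zᵢ + (- β) * wᵢ
    coordinate zᵢ wᵢ = trans (+-cong (*-congʳ xyw≈α) (*-congˡ (*-congʳ xyz≈β)))
      (solve 4 (λ α β zᵢ wᵢ → α :* zᵢ :+ :- :1 :* (β :* wᵢ) := α :* zᵢ :+ (:- β) :* wᵢ) refl α β zᵢ wᵢ)

  br-binomial : ∀ {α β γ δ ε ζ} x x′ y y′ z z′ {t₁ t₂ t₃ t₄ t₅ t₆ t₇ t₈} →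
    br x y z ≈ t₁ → br x y z′ ≈ t₂ → br x y′ z ≈ t₃ → br x y′ z′ ≈ t₄ →
    br x′ y z ≈ t₅ → br x′ y z′ ≈ t₆ → br x′ y′ z ≈ t₇ → br x′ y′ z′ ≈ t₈ →
    br (α · x +ᵥ β · x′) (γ · y +ᵥ δ · y′) (ε · z +ᵥ ζ · z′)
      ≈ α * (γ * (ε * t₁ + ζ * t₂) + δ * (ε * t₃ + ζ * t₄)) + β * (γ * (ε * t₅ + ζ * t₆) + δ * (ε * t₇ + ζ * t₈))
  br-binomial {α} {β} {γ} {δ} {ε} {ζ} x x′ y y′ z z′ e₁ e₂ e₃ e₄ e₅ e₆ e₇ e₈ =
    trans (lin₁ α β x x′ _ _) (+-cong
      (*-congˡ (trans (lin₂ γ δ x y y′ _) (+-cong (*-congˡ (expandᶻ x y e₁ e₂)) (*-congˡ (expandᶻ x y′ e₃ e₄)))))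
      (*-congˡ (trans (lin₂ γ δ x′ y y′ _) (+-cong (*-congˡ (expandᶻ x′ y e₅ e₆)) (*-congˡ (expandᶻ x′ y′ e₇ e₈))))))
    where
    expandᶻ : ∀ u v {s t} → br u v z ≈ s → br u v z′ ≈ t → br u v (ε · z +ᵥ ζ · z′) ≈ ε * s + ζ * t
    expandᶻ u v uvz≈s uvz′≈t = trans (lin₃ ε ζ u v z z′) (+-cong (*-congˡ uvz≈s) (*-congˡ uvz′≈t))

  yq-xp≈xu-yw : ∀ {x y p q u w} → p + u ≈ y → q + w ≈ x → y * q - x * p ≈ x * u - y * w
  yq-xp≈xu-yw {x} {y} {p} {q} {u} {w} p+u≈y q+w≈x = begin
    y * q - x * p                                    ≈⟨ solve 6 (λ x y p q u w →
                                                          y :* q :- x :* p := y :* (q :+ w) :- x :* (p :+ u) :+ (x :* u :- y :* w))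
                                                          refl x y p q u w ⟩
    y * (q + w) - x * (p + u) + (x * u - y * w)      ≈⟨ +-congʳ (+-cong (*-congˡ q+w≈x) (-‿cong (*-congˡ p+u≈y))) ⟩
    y * x - x * y + (x * u - y * w)                  ≈⟨ solve 4 (λ x y u w →
                                                          y :* x :- x :* y :+ (x :* u :- y :* w) := x :* u :- y :* w)
                                                          refl x y u w ⟩
    x * u - y * w                                    ∎

  lhs-expansion : ∀ a b c a' b' c' →
    join3 (meet b c' b' c) (meet c a' c' a) (meet a b' a' b)
      ≈ br b' a a' * br b' b c' * (br c a b * br c a' c') - br c a a' * br c b c' * (br b' a b * br b' a' c')
  lhs-expansion a b c a' b' c' = begin
    join3 (meet b c' b' c) (meet c a' c' a) (meet a b' a' b)
      ≈⟨ cong-br (meet≈ b c' b' c (br-rotate c b c') (br-rotate b' b c'))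
                 (meet≈ c a' c' a (br-swap₂₃ c a a') refl)
                 (meet≈ a b' a' b (br-swap₁₂ b' a b) (br-swap₁₂ b' a a')) ⟩
    br (br c b c' · b' +ᵥ (- br b' b c') · c) ((- br c a a') · c' +ᵥ (- br c a' c') · a)
       ((- br b' a b) · a' +ᵥ (- - br b' a a') · b)
      ≈⟨ br-binomial b' c c' a a' b (br-swap₂₃ b' a' c') (br-swap₂₃ b' b c') refl refl
                                    (br-swap₂₃ c a' c') (br-swap₂₃ c b c') refl refl ⟩
    _ ≈⟨ solve 8 (λ BaA BbC Bab BAC caA cbC cab cAC →
           :binomial cbC (:- BbC) (:- caA) (:- cAC) (:- Bab) (:- :- BaA)
                     (:- BAC) (:- BbC) BaA Bab (:- cAC) (:- cbC) caA cab
             := BaA :* BbC :* (cab :* cAC) :- caA :* cbC :* (Bab :* BAC))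
           refl (br b' a a') (br b' b c') (br b' a b) (br b' a' c') (br c a a') (br c b c') (br c a b) (br c a' c') ⟩
    br b' a a' * br b' b c' * (br c a b * br c a' c') - br c a a' * br c b c' * (br b' a b * br b' a' c') ∎

  rhs-expansion : ∀ a b c a' b' c' →
    join3 (meet c' b b' c) (meet c a' a b) (meet a b' a' c')
      ≈ br c a a' * br c b c' * (br b' a c' * br b' b a') - br b' a a' * br b' b c' * (br c a c' * br c b a')
  rhs-expansion a b c a' b' c' = begin
    join3 (meet c' b b' c) (meet c a' a b) (meet a b' a' c')
      ≈⟨ cong-br (meet≈ c' b b' c (trans (br-rotate c c' b) (br-swap₂₃ c b c'))
                                  (trans (br-rotate b' c' b) (br-swap₂₃ b' b c')))
                 (meet≈ c a' a b (br-swap₂₃ c b a') (br-swap₂₃ c a a'))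
                 (meet≈ a b' a' c' (br-swap₁₂ b' a c') (br-swap₁₂ b' a a')) ⟩
    br ((- br c b c') · b' +ᵥ (- - br b' b c') · c) ((- br c b a') · a +ᵥ (- - br c a a') · b)
       ((- br b' a c') · a' +ᵥ (- - br b' a a') · c')
      ≈⟨ br-binomial b' c a b a' c' refl refl refl refl refl refl refl refl ⟩
    _ ≈⟨ solve 8 (λ BaA BaC BbA BbC caA caC cbA cbC →
           :binomial (:- cbC) (:- :- BbC) (:- cbA) (:- :- caA) (:- BaC) (:- :- BaA)
                     BaA BaC BbA BbC caA caC cbA cbC
             := caA :* cbC :* (BaC :* BbA) :- BaA :* BbC :* (caC :* cbA))
           refl (br b' a a') (br b' a c') (br b' b a') (br b' b c') (br c a a') (br c a c') (br c b a') (br c b c') ⟩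
    br c a a' * br c b c' * (br b' a c' * br b' b a') - br b' a a' * br b' b c' * (br c a c' * br c b a') ∎

theorem1 : ∀ {c ℓ : Level} (K : CommutativeRing c ℓ) → IsField K →
    let open CommutativeRing K using (_≈_)
        open GC K
    in (br : V → V → V → CommutativeRing.Carrier K) → IsBracket br →
       let open Bracket br
       in ∀ a b c a' b' c' →
          join3 (meet b c' b' c) (meet c a' c' a) (meet a b' a' b)
            ≈ join3 (meet c' b b' c) (meet c a' a b) (meet a b' a' c')
theorem1 K _ br isBracket a b c a' b' c' = begin
  join3 (meet b c' b' c) (meet c a' c' a) (meet a b' a' b)
    ≈⟨ lhs-expansion a b c a' b' c' ⟩
  br b' a a' * br b' b c' * (br c a b * br c a' c') - br c a a' * br c b c' * (br b' a b * br b' a' c')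
    ≈⟨ yq-xp≈xu-yw (grassmann-plücker b' a b a' c') (grassmann-plücker c a b a' c') ⟩
  br c a a' * br c b c' * (br b' a c' * br b' b a') - br b' a a' * br b' b c' * (br c a c' * br c b a')
    ≈⟨ rhs-expansion a b c a' b' c' ⟨
  join3 (meet c' b b' c) (meet c a' a b) (meet a b' a' c') ∎
  where
  open CommutativeRing K
  open GC K
  open Bracket br
  open BracketProperties K br isBracket
  open import Relation.Binary.Reasoning.Setoid setoid
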